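{- Let $\mathcal{F}$ be a countable collection of functions $f:\mathbb{Z}\to\mathbb{Z}$ with $f(n)\to+\infty$ as $n\to+\infty$ for each $f\in\mathcal{F}$. Let $\mathcal{F}_1,\mathcal{F}_2,\dots$ be an enumeration of all nonempty finite subsets of $\mathcal{F}$, set $n_0=0$ and $n_k=\#\mathcal{F}_1+\dots+\#\mathcal{F}_k$ for $k\ge1$. Fix an integer $a>4$ and let $\{t_k\}_{k\ge1}$ be positive integers such that $\min_{f\in\mathcal{F}_k}f(t_k)>2a^{n_k^2}$ and $\min_{f\in\mathcal{F}_{k+1}}f(t_{k+1})>\max_{f\in\mathcal{F}_k}f(t_k)$ for all $k\ge1$. Let $\{b_m\}_{m\ge1}$ be the elements of $\{f(t_k): f\in\mathcal{F}_k, k\ge1\}$ listed in increasing order. Then $\#\{m: b_m<2a^n\}<\sqrt n$ for all $n\ge1$. -}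

module Defs where

open import Data.Nat as ℕ using (ℕ; zero; suc)
open import Data.Integer as ℤ using (ℤ; +_)
open import Data.List using (List; []; length)
open import Data.List.Membership.Propositional using (_∈_)
open import Data.List.Relation.Unary.Unique.Propositional using (Unique)
open import Data.Product using (_×_; ∃-syntax)
open import Function.Bundles using (_⇔_)
open import Relation.Binary.PropositionalEquality using (_≡_; _≢_)
open import Relation.Nullary using (¬_)

TendsToInfinity : (ℤ → ℤ) → Set
TendsToInfinity f = ∀ (M : ℤ) → ∃[ N ] (∀ (n : ℤ) → N ℤ.≤ n → M ℤ.≤ f n)

-- The countable (infinite) collection 𝓕 is given by an enumeration Fn : ℕ → (ℤ → ℤ)
-- listing each member exactly once: distinct indices give (extensionally) distinct functions.
DistinctFunctions : (ℕ → ℤ → ℤ) → Set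
DistinctFunctions Fn = ∀ i j → i ≢ j → ¬ (∀ x → Fn i x ≡ Fn j x)

-- A nonempty finite subset of 𝓕, represented by a duplicate-free nonempty list of indices.
NonEmptyFinSubset : List ℕ → Set
NonEmptyFinSubset L = Unique L × (L ≢ [])

SameSet : List ℕ → List ℕ → Set
SameSet L L' = ∀ i → (i ∈ L) ⇔ (i ∈ L')

-- S k represents 𝓕_{k+1}; S is an enumeration (each nonempty finite subset exactly once).
IsEnumeration : (ℕ → List ℕ) → Set
IsEnumeration S =
  (∀ k → NonEmptyFinSubset (S k))
  × (∀ L → NonEmptyFinSubset L → ∃[ k ] SameSet (S k) L)
  × (∀ k j → SameSet (S k) (S j) → k ≡ j)

partialSize : (ℕ → List ℕ) → ℕ → ℕ
partialSize S zero = 0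
partialSize S (suc k) = partialSize S k ℕ.+ length (S k)

-- x ∈ {f(t_k) : f ∈ 𝓕_k, k ≥ 1}   (0-indexed: 𝓕_{k+1} = S k, t_{k+1} = t k)
InB : (ℕ → ℤ → ℤ) → (ℕ → List ℕ) → (ℕ → ℤ) → ℤ → Set
InB Fn S t x = ∃[ k ] ∃[ i ] ((i ∈ S k) × (Fn i (t k) ≡ x))

-- An element f(t_k) of the sequence lies below 2a^n only if 2a^(n_k^2) < 2a^n, that is n_k^2 < n.
-- Taking the largest such block index m, every b_m < 2a^n occurs among the n_m values produced
-- by the first m blocks, so there are at most n_m of them and their number squared is below n.
-- Only the lower bound on the f(t_k) enters.
module Submission where

open import Defs
open import Data.Nat as ℕ using (ℕ; suc)
open import Data.Integer as ℤ using (ℤ; +_)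
open import Data.List using (List; length)
open import Data.List.Membership.Propositional using (_∈_)
open import Data.List.Relation.Unary.Unique.Propositional using (Unique)
open import Data.List.Relation.Unary.All using (All)
open import Data.Product using (_×_)

open import Level using (Level)
open import Data.Nat using (zero; z≤n; s≤s; _≤_; _<_; _^_; NonZero)
open import Data.Nat.Properties
import Data.Integer.Properties as ℤ
open import Data.List using ([]; _∷_; _++_; map)
open import Data.List.Properties using (length-++; length-map)
open import Data.List.Membership.Propositional.Properties using (∈-∃++; ∈-++⁻; ∈-++⁺ˡ; ∈-++⁺ʳ; ∈-map⁺)
open import Data.List.Relation.Binary.Subset.Propositional using (_⊆_)
open import Data.List.Relation.Unary.Any using (here; there)
open import Data.List.Relation.Unary.All using ([]; _∷_; lookup)
import Data.List.Relation.Unary.All as All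
open import Data.List.Relation.Unary.AllPairs using (_∷_)
open import Data.Product using (_,_; ∃-syntax)
open import Data.Sum using (inj₁; inj₂)
open import Data.Empty using (⊥-elim)
open import Relation.Binary.PropositionalEquality using (_≡_; refl; cong; cong₂; trans)

private
  variable
    ℓ : Level
    A : Set ℓ

Unique-⊆⇒length≤ : {xs ys : List A} → Unique xs → xs ⊆ ys → length xs ≤ length ys
Unique-⊆⇒length≤ {xs = []} _ _ = z≤n
Unique-⊆⇒length≤ {xs = x ∷ xs} {ys} (x∉xs ∷ unique) xs⊆ys with ∈-∃++ (xs⊆ys (here refl))
... | us , vs , refl = begin
    suc (length xs)               ≤⟨ s≤s (Unique-⊆⇒length≤ unique xs⊆us++vs) ⟩
    suc (length (us ++ vs))       ≡⟨ cong suc (length-++ us) ⟩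
    suc (length us ℕ.+ length vs) ≡⟨ +-suc (length us) (length vs) ⟨
    length us ℕ.+ suc (length vs) ≡⟨ length-++ us ⟨
    length (us ++ x ∷ vs)         ∎
  where
  open ≤-Reasoning
  xs⊆us++vs : xs ⊆ us ++ vs
  xs⊆us++vs y∈xs with ∈-++⁻ us (xs⊆ys (there y∈xs))
  ... | inj₁ y∈us         = ∈-++⁺ˡ y∈us
  ... | inj₂ (here refl)  = ⊥-elim (lookup x∉xs y∈xs refl)
  ... | inj₂ (there y∈vs) = ∈-++⁺ʳ us y∈vs

covered⇒⊆-stage : (V : ℕ → List A) → (∀ {j m} → j ≤ m → V j ⊆ V m) → (P : ℕ → Set) → P 0
        → {xs : List A} → All (λ x → ∃[ k ] (P k × x ∈ V k)) xs → ∃[ m ] (P m × xs ⊆ V m)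
covered⇒⊆-stage V mono P P0 [] = 0 , P0 , λ ()
covered⇒⊆-stage V mono P P0 ((k , Pk , x∈Vk) ∷ covered) with covered⇒⊆-stage V mono P P0 covered
... | m , Pm , xs⊆Vm with ≤-total k m
...   | inj₁ k≤m = m , Pm , λ { (here refl) → mono k≤m x∈Vk ; (there y∈xs) → xs⊆Vm y∈xs }
...   | inj₂ m≤k = k , Pk , λ { (here refl) → x∈Vk ; (there y∈xs) → mono m≤k (xs⊆Vm y∈xs) }

^-cancelʳ-< : ∀ a .{{_ : NonZero a}} {m n} → a ^ m < a ^ n → m < n
^-cancelʳ-< a aᵐ<aⁿ = ≰⇒> λ n≤m → <⇒≱ aᵐ<aⁿ (^-monoʳ-≤ a n≤m)

module Values (Fn : ℕ → ℤ → ℤ) (S : ℕ → List ℕ) (t : ℕ → ℤ) where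

  values : ℕ → List ℤ
  values zero    = []
  values (suc k) = values k ++ map (λ i → Fn i (t k)) (S k)

  length-values : ∀ k → length (values k) ≡ partialSize S k
  length-values zero    = refl
  length-values (suc k) =
    trans (length-++ (values k)) (cong₂ ℕ._+_ (length-values k) (length-map _ (S k)))

  values-mono : ∀ {j m} → j ≤ m → values j ⊆ values m
  values-mono {m = zero}  z≤n x∈ = x∈
  values-mono {m = suc m} j≤1+m x∈ with m≤n⇒m<n∨m≡n j≤1+m
  ... | inj₁ (s≤s j≤m) = ∈-++⁺ˡ (values-mono j≤m x∈)
  ... | inj₂ refl      = x∈

  ∈-values : ∀ {k i} → i ∈ S k → Fn i (t k) ∈ values (suc k)
  ∈-values {k} i∈Sk = ∈-++⁺ʳ (values k) (∈-map⁺ (λ i → Fn i (t k)) i∈Sk)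

open Values

lemma3p1 : (Fn : ℕ → ℤ → ℤ) → DistinctFunctions Fn → (∀ i → TendsToInfinity (Fn i))
    → (S : ℕ → List ℕ) → IsEnumeration S
    → (a : ℕ) → 4 ℕ.< a
    → (t : ℕ → ℤ) → (∀ k → + 0 ℤ.< t k)
    → (∀ k i → i ∈ S k → + (2 ℕ.* a ℕ.^ (partialSize S (suc k) ℕ.^ 2)) ℤ.< Fn i (t k))
    → (∀ k i j → i ∈ S (suc k) → j ∈ S k → Fn j (t k) ℤ.< Fn i (t (suc k)))
    → ∀ (n : ℕ) → 1 ℕ.≤ n
    → ∀ (L : List ℤ) → Unique L
    → All (λ x → InB Fn S t x × (x ℤ.< + (2 ℕ.* a ℕ.^ n))) L
    → length L ℕ.^ 2 ℕ.< n
lemma3p1 Fn _ _ S _ a 4<a t _ lower _ n 1≤n L unique small =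
  bound (covered⇒⊆-stage (values Fn S t) (values-mono Fn S t) Below 1≤n (All.map level small))
  where
  instance
    a≢0 : NonZero a
    a≢0 = ℕ.>-nonZero (<-trans (s≤s z≤n) 4<a)

  Below : ℕ → Set
  Below k = partialSize S k ^ 2 < n

  level : ∀ {x} → InB Fn S t x × (x ℤ.< + (2 ℕ.* a ^ n)) → ∃[ k ] (Below k × x ∈ values Fn S t k)
  level ((k , i , i∈Sk , refl) , x<2aⁿ) = suc k , nₖ₊₁²<n , ∈-values Fn S t i∈Sk
    where
    nₖ₊₁²<n : Below (suc k)
    nₖ₊₁²<n = ^-cancelʳ-< a (*-cancelˡ-< 2 _ _ (ℤ.drop‿+<+ (ℤ.<-trans (lower k i i∈Sk) x<2aⁿ)))

  bound : ∃[ m ] (Below m × L ⊆ values Fn S t m) → length L ^ 2 < n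
  bound (m , nₘ²<n , L⊆) = begin-strict
    length L ^ 2                 ≤⟨ ^-monoˡ-≤ 2 (Unique-⊆⇒length≤ unique L⊆) ⟩
    length (values Fn S t m) ^ 2 ≡⟨ cong (_^ 2) (length-values Fn S t m) ⟩
    partialSize S m ^ 2          <⟨ nₘ²<n ⟩
    n                            ∎
    where open ≤-Reasoning
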